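{- Let $G$ be a connected graph with no true twins and with ${\rm diam}(G) = 2$. Then ${\rm gp}(G) = \omega(G_{\rm SR})$ if and only if ${\rm gp}(G) = \alpha(G)$.
   Context: All graphs are finite and simple. For a connected graph $G$, a set $S\subseteq V(G)$ is a general position set if no three pairwise distinct vertices of $S$ lie on a common geodesic (shortest path) of $G$; ${\rm gp}(G)$ is the maximum cardinality of a general position set. Vertices $u,v$ are true twins if $N[u]=N[v]$ (closed neighborhoods). A vertex $u$ is maximally distant from $v$ if every neighbor $w$ of $u$ satisfies $d_G(v,w)\le d_G(u,v)$; $u$ and $v$ are mutually maximally distant (MMD) if each is maximally distant from the other. The strong resolving graph $G_{\rm SR}$ has vertex set $V(G)$, two vertices being adjacent iff they are MMD in $G$. $\omega$ denotes the clique number and $\alpha$ the independence number. -}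

module Defs where

open import Data.Nat using (ℕ; zero; suc; _+_; _≤_)
open import Data.Fin using (Fin)
open import Data.Fin.Subset using (Subset; _∈_; ∣_∣)
open import Data.Product using (Σ; ∃; _×_; _,_)
open import Data.Sum using (_⊎_)
open import Data.Empty using (⊥)
open import Relation.Nullary using (¬_)
open import Relation.Binary using (Decidable)
open import Relation.Binary.PropositionalEquality using (_≡_; _≢_)

record Graph : Set₁ where
  field
    n       : ℕ
    Adj     : Fin n → Fin n → Set
    adj?    : Decidable Adj
    sym     : ∀ {u v} → Adj u v → Adj v u
    irrefl  : ∀ {u} → ¬ Adj u u

module _ (G : Graph) where
  open Graph G

  data Walk : Fin n → Fin n → ℕ → Set where
    here : ∀ {u} → Walk u u zero
    step : ∀ {u w v k} → Adj u w → Walk w v k → Walk u v (suc k)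

  data OnWalk (x : Fin n) : ∀ {u v k} → Walk u v k → Set where
    on-here  : ∀ {v k} {p : Walk x v k} → OnWalk x p
    on-there : ∀ {u w v k} {a : Adj u w} {p : Walk w v k} → OnWalk x p → OnWalk x (step a p)

  Dist : Fin n → Fin n → ℕ → Set
  Dist u v k = Walk u v k × (∀ m → Walk u v m → k ≤ m)

  Connected : Set
  Connected = ∀ u v → ∃ λ k → Walk u v k

  Diam2 : Set
  Diam2 = (∀ u v k → Dist u v k → k ≤ 2) × (∃ λ u → ∃ λ v → Dist u v 2)

  InClosedNbhd : Fin n → Fin n → Set
  InClosedNbhd u w = (w ≡ u) ⊎ Adj u w

  TrueTwins : Fin n → Fin n → Set
  TrueTwins u v = u ≢ v × (∀ w → (InClosedNbhd u w → InClosedNbhd v w) × (InClosedNbhd v w → InClosedNbhd u w))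

  NoTrueTwins : Set
  NoTrueTwins = ∀ u v → ¬ TrueTwins u v

  Geodesic : ∀ {u v k} → Walk u v k → Set
  Geodesic {u} {v} {k} _ = Dist u v k

  OnCommonGeodesic : Fin n → Fin n → Fin n → Set
  OnCommonGeodesic x y z =
    Σ (Fin n) λ u → Σ (Fin n) λ v → Σ ℕ λ k → Σ (Walk u v k) λ p →
      Geodesic p × OnWalk x p × OnWalk y p × OnWalk z p

  GeneralPosition : Subset n → Set
  GeneralPosition S = ∀ x y z → x ∈ S → y ∈ S → z ∈ S →
    x ≢ y → y ≢ z → x ≢ z → ¬ OnCommonGeodesic x y z

  MaxDistantFrom : Fin n → Fin n → Set
  MaxDistantFrom u v = ∀ w k l → Adj u w → Dist v w k → Dist u v l → k ≤ l

  -- mutually maximally distant = adjacency in the strong resolving graph G_SR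
  MMD : Fin n → Fin n → Set
  MMD u v = MaxDistantFrom u v × MaxDistantFrom v u

  SRClique : Subset n → Set
  SRClique S = ∀ x y → x ∈ S → y ∈ S → x ≢ y → MMD x y

  Independent : Subset n → Set
  Independent S = ∀ x y → x ∈ S → y ∈ S → ¬ Adj x y

  IsMaxCard : (Subset n → Set) → ℕ → Set
  IsMaxCard P k = (Σ (Subset n) λ S → P S × ∣ S ∣ ≡ k) × (∀ S → P S → ∣ S ∣ ≤ k)

  IsGP IsOmegaSR IsAlpha : ℕ → Set
  IsGP      = IsMaxCard GeneralPosition
  IsOmegaSR = IsMaxCard SRClique
  IsAlpha   = IsMaxCard Independent

module Submission where

-- In a graph of diameter at most 2 without true twins, two distinct
-- vertices are mutually maximally distant exactly when they are non-adjacent: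
--   * non-adjacent distinct u, v are at distance ≥ 2, the largest possible
--     distance, so each is trivially maximally distant from the other;
--   * if u and v are adjacent and u is maximally distant from v, then every
--     neighbour of u is within distance 1 of v, i.e. N[u] ⊆ N[v]; for an MMD
--     pair this holds in both directions, making u, v true twins.
-- Hence G_SR is the complement of G, its cliques are exactly the independent
-- sets of G, and ω(G_SR) = α(G).

open import Defs
open import Data.Nat using (ℕ; _≤_; z≤n; s≤s)
open import Data.Nat.Properties using (≤-antisym; ≤-trans)
open import Data.Fin using (_≟_)
open import Data.Fin.Subset using (Subset; ∣_∣)
open import Data.Product using (_×_; _,_; proj₁; proj₂)
open import Data.Sum using (inj₁; inj₂)
open import Data.Empty using (⊥-elim)
open import Relation.Nullary using (¬_; yes; no)
open import Relation.Binary.PropositionalEquality using (_≡_; _≢_; refl; sym; trans; subst)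

module _ (G : Graph) where
  open Graph G renaming (sym to adj-sym)

  DiamAtMost2 : Set
  DiamAtMost2 = ∀ u v k → Dist G u v k → k ≤ 2

  distinct⇒walk≥1 : ∀ {u v} → u ≢ v → ∀ m → Walk G u v m → 1 ≤ m
  distinct⇒walk≥1 u≢v _ here       = ⊥-elim (u≢v refl)
  distinct⇒walk≥1 u≢v _ (step _ _) = s≤s z≤n

  nonadjacent⇒walk≥2 : ∀ {u v} → u ≢ v → ¬ Adj u v → ∀ m → Walk G u v m → 2 ≤ m
  nonadjacent⇒walk≥2 u≢v _   _ here                = ⊥-elim (u≢v refl)
  nonadjacent⇒walk≥2 _   ¬uv _ (step uv here)      = ⊥-elim (¬uv uv)
  nonadjacent⇒walk≥2 _   _   _ (step _ (step _ _)) = s≤s (s≤s z≤n)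

  adjacent⇒dist1 : ∀ {u v} → Adj u v → Dist G u v 1
  adjacent⇒dist1 uv = step uv here , distinct⇒walk≥1 (λ { refl → irrefl uv })

  commonNeighbour⇒dist2 : ∀ {u w v} → v ≢ u → ¬ Adj v u → Adj v w → Adj w u → Dist G v u 2
  commonNeighbour⇒dist2 v≢u ¬vu vw wu = step vw (step wu here) , nonadjacent⇒walk≥2 v≢u ¬vu

  -- In diameter ≤ 2, a vertex is maximally distant from any distinct
  -- non-adjacent vertex, since their distance 2 is already the maximum.
  nonadjacent⇒maxDistant : DiamAtMost2 → ∀ {u v} → u ≢ v → ¬ Adj u v → MaxDistantFrom G u v
  nonadjacent⇒maxDistant diam u≢v ¬uv w k l _ dvw duv =
    ≤-trans (diam _ w k dvw) (nonadjacent⇒walk≥2 u≢v ¬uv l (proj₁ duv))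

  maxDistantNeighbour⇒closedNbhd⊆ : ∀ {u v} → Adj u v → MaxDistantFrom G u v →
    ∀ w → InClosedNbhd G u w → InClosedNbhd G v w
  maxDistantNeighbour⇒closedNbhd⊆ uv _ w (inj₁ refl) = inj₂ (adj-sym uv)
  maxDistantNeighbour⇒closedNbhd⊆ {u} {v} uv maxDist w (inj₂ uw) with w ≟ v | adj? v w
  ... | yes w≡v | _      = inj₁ w≡v
  ... | no _    | yes vw = inj₂ vw
  ... | no w≢v  | no ¬vw = ⊥-elim (2≰1 (maxDist w 2 1 uw dist-v-w (adjacent⇒dist1 uv)))
    where
    dist-v-w : Dist G v w 2
    dist-v-w = commonNeighbour⇒dist2 (λ v≡w → w≢v (sym v≡w)) ¬vw (adj-sym uv) uw
    2≰1 : ¬ (2 ≤ 1)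
    2≰1 (s≤s ())

  adjacentMMD⇒trueTwins : ∀ {u v} → Adj u v → MMD G u v → TrueTwins G u v
  adjacentMMD⇒trueTwins uv (u-from-v , v-from-u) =
    (λ { refl → irrefl uv }) ,
    λ w → maxDistantNeighbour⇒closedNbhd⊆ uv u-from-v w ,
          maxDistantNeighbour⇒closedNbhd⊆ (adj-sym uv) v-from-u w

  independent⇒SRClique : DiamAtMost2 → ∀ S → Independent G S → SRClique G S
  independent⇒SRClique diam S ind x y x∈S y∈S x≢y =
    nonadjacent⇒maxDistant diam x≢y (ind x y x∈S y∈S) ,
    nonadjacent⇒maxDistant diam (λ y≡x → x≢y (sym y≡x)) (ind y x y∈S x∈S)

  SRClique⇒independent : NoTrueTwins G → ∀ S → SRClique G S → Independent G S
  SRClique⇒independent noTwins S clique x y x∈S y∈S xy =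
    noTwins x y (adjacentMMD⇒trueTwins xy (clique x y x∈S y∈S (λ { refl → irrefl xy })))

  equivalent⇒sameMaxCard : ∀ {P Q : Subset n → Set} {k j} →
    (∀ S → P S → Q S) → (∀ S → Q S → P S) → IsMaxCard G P k → IsMaxCard G Q j → k ≡ j
  equivalent⇒sameMaxCard P⇒Q Q⇒P ((S , PS , ∣S∣≡k) , maxP) ((T , QT , ∣T∣≡j) , maxQ) =
    ≤-antisym (subst (_≤ _) ∣S∣≡k (maxQ S (P⇒Q S PS)))
              (subst (_≤ _) ∣T∣≡j (maxP T (Q⇒P T QT)))

  omegaSR≡alpha : NoTrueTwins G → DiamAtMost2 → ∀ {ω α} → IsOmegaSR G ω → IsAlpha G α → ω ≡ α
  omegaSR≡alpha noTwins diam =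
    equivalent⇒sameMaxCard (SRClique⇒independent noTwins) (independent⇒SRClique diam)

proposition2p4 : (G : Graph) → Connected G → NoTrueTwins G → Diam2 G →
    (gp ω α : ℕ) → IsGP G gp → IsOmegaSR G ω → IsAlpha G α →
    ((gp ≡ ω → gp ≡ α) × (gp ≡ α → gp ≡ ω))
proposition2p4 G _ noTwins diam2 gp ω α _ isω isα =
  (λ gp≡ω → trans gp≡ω ω≡α) , (λ gp≡α → trans gp≡α (sym ω≡α))
  where
  ω≡α : ω ≡ α
  ω≡α = omegaSR≡alpha G noTwins (proj₁ diam2) isω isα
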